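{- There exists a uniform Šoltés' hypergraph which is not regular. Specifically, the $9$-uniform hypergraph $H$ with vertex set $\mathbb{Z}/54\mathbb{Z}$ and the $27$ hyperedges $\{a,a+1,a+2,a+3,a+4,a+5,a+7,a+16,a+18\}$ for even $a\in\mathbb{Z}/54\mathbb{Z}$ (arithmetic modulo $54$) is a Šoltés' hypergraph that is not regular.
   Context: A hypergraph $H=(V,E)$ consists of a finite vertex set $V$ and a set $E$ of distinct subsets of $V$ (hyperedges). $H$ is $k$-uniform if every hyperedge has exactly $k$ elements, and uniform if it is $k$-uniform for some $k\ge 2$. The degree of a vertex is the number of hyperedges containing it; $H$ is regular if all vertices have the same degree. For $u,w\in V$, the distance $d_H(u,w)$ is the least $\ell\ge 0$ such that there are vertices $u=x_0,\dots,x_\ell=w$ with $x_{i-1},x_i$ contained in a common hyperedge for each $i$ ($\infty$ if none exists); $H$ is connected if all distances are finite. $W(H)=\sum_{\{u,w\}\subseteq V,\,u\ne w} d_H(u,w)$. For $v\in V$, $H\setminus v$ has vertex set $V\setminus\{v\}$ and hyperedge set $\{e\in E: v\notin e\}$. A Šoltés' hypergraph is a connected hypergraph $H$ with $W(H\setminus v)=W(H)$ for every $v\in V$. -}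

module Defs where

open import Data.Nat using (ℕ; zero; suc; _+_; _*_; _<_; _≤_; _<ᵇ_)
open import Data.Nat.DivMod using (_%_; m%n<n)
open import Data.Bool using (Bool; true; false; if_then_else_; _∧_)
open import Data.Fin using (Fin; toℕ; fromℕ<)
open import Data.Fin.Subset using (Subset; _∈_; _⊆_; ⁅_⁆; ∣_∣; ∁; _∩_; _∪_)
open import Data.Fin.Subset.Properties using (_∈?_)
open import Data.Vec using (lookup)
open import Data.List using (List; []; _∷_; map; filter; length; allFin; foldr)
open import Data.Nat.ListAction using (sum)
open import Data.List.Membership.Propositional using () renaming (_∈_ to _∈ₗ_)
open import Data.List.Relation.Unary.All using (All)
open import Data.List.Relation.Unary.Unique.Propositional using (Unique)
open import Data.Product using (Σ; ∃; _×_; _,_)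
open import Relation.Nullary using (¬_; ¬?)
open import Relation.Binary.PropositionalEquality using (_≡_; _≢_)

record Hypergraph : Set where
  constructor hypergraph
  field
    n        : ℕ
    vertices : Subset n
    edges    : List (Subset n)
open Hypergraph public

-- Well-formedness: every hyperedge is a subset of V, and hyperedges are distinct
-- (so the list represents a *set* E of subsets of V).
IsHypergraph : Hypergraph → Set
IsHypergraph H = All (λ e → e ⊆ vertices H) (edges H) × Unique (edges H)

KUniform : ℕ → Hypergraph → Set
KUniform k H = All (λ e → ∣ e ∣ ≡ k) (edges H)

Uniform : Hypergraph → Set
Uniform H = Σ ℕ λ k → 2 ≤ k × KUniform k H

degree : (H : Hypergraph) → Fin (n H) → ℕ
degree H v = length (filter (λ e → v ∈? e) (edges H))

Regular : Hypergraph → Set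
Regular H = ∀ u w → u ∈ vertices H → w ∈ vertices H → degree H u ≡ degree H w

Adj : (H : Hypergraph) → Fin (n H) → Fin (n H) → Set
Adj H x y = Σ (Subset (n H)) λ e → e ∈ₗ edges H × x ∈ e × y ∈ e

data Walk (H : Hypergraph) : ℕ → Fin (n H) → Fin (n H) → Set where
  stop : ∀ {u} → Walk H 0 u u
  step : ∀ {ℓ u x w} → Adj H u x → Walk H ℓ x w → Walk H (suc ℓ) u w

IsDist : (H : Hypergraph) → Fin (n H) → Fin (n H) → ℕ → Set
IsDist H u w d = Walk H d u w × (∀ ℓ → ℓ < d → ¬ Walk H ℓ u w)

Connected : Hypergraph → Set
Connected H = ∀ u w → u ∈ vertices H → w ∈ vertices H → ∃ λ ℓ → Walk H ℓ u w

-- sum of δ u w over unordered pairs {u,w} of distinct vertices (taken as toℕ u < toℕ w)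
pairSum : (H : Hypergraph) → (Fin (n H) → Fin (n H) → ℕ) → ℕ
pairSum H δ = sum (map (λ u → sum (map (λ w →
    if lookup (vertices H) u ∧ lookup (vertices H) w ∧ (toℕ u <ᵇ toℕ w)
    then δ u w else 0) (allFin (n H)))) (allFin (n H)))

WienerIs : Hypergraph → ℕ → Set
WienerIs H m = Σ (Fin (n H) → Fin (n H) → ℕ) λ δ →
  (∀ u w → u ∈ vertices H → w ∈ vertices H → u ≢ w → IsDist H u w (δ u w))
  × m ≡ pairSum H δ

delete : (H : Hypergraph) → Fin (n H) → Hypergraph
delete H v = hypergraph (n H) (vertices H ∩ ∁ ⁅ v ⁆)
                        (filter (λ e → ¬? (v ∈? e)) (edges H))

-- Šoltés' hypergraph: connected and W(H \ v) = W(H) for every vertex v.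
-- (H connected ⇒ W(H) finite; so W(H\v) = W(H) forces W(H\v) finite as well.)
Soltes : Hypergraph → Set
Soltes H = Connected H ×
  (∀ v → v ∈ vertices H → Σ ℕ λ m → WienerIs H m × WienerIs (delete H v) m)

-- The concrete hypergraph on ℤ/54ℤ ≅ Fin 54
mod54 : ℕ → Fin 54
mod54 k = fromℕ< (m%n<n k 54)

fromList : ∀ {m} → List (Fin m) → Subset m
fromList = foldr (λ x s → ⁅ x ⁆ ∪ s) Data.Fin.Subset.⊥

edgeAt : ℕ → Subset 54
edgeAt a = fromList (map (λ o → mod54 (a + o)) (0 ∷ 1 ∷ 2 ∷ 3 ∷ 4 ∷ 5 ∷ 7 ∷ 16 ∷ 18 ∷ []))

H54 : Hypergraph
H54 = hypergraph 54 Data.Fin.Subset.⊤ (map (λ (i : Fin 27) → edgeAt (2 * toℕ i)) (allFin 27))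

-- Breadth-first search to depth 4 computes every distance in H54 and in each H54 ∖ v, and
-- certifies it: the vertices ending walks of length k from u are exactly the k-th iterate of the
-- neighbourhood operator on {u}, so the first level at which w appears is witnessed by a walk
-- and no shorter walk exists. Evaluating the searches gives W(H54) = W(H54 ∖ v) = 2349 for every v.

module Submission where

open import Defs
open import Data.Bool using (true; if_then_else_)
open import Data.Empty using (⊥-elim)
open import Data.Fin using (Fin; zero; suc)
open import Data.Fin.Properties using (all?)
open import Data.Fin.Subset using (Subset; _∈_; _∉_; _∩_; ⋃; ⁅_⁆; ∣_∣; Nonempty; inside; outside)
open import Data.Fin.Subset.Properties
  using (_∈?_; x∈p∩q⁺; x∈p∩q⁻; x∈p∪q⁺; x∈p∪q⁻; x∈⁅x⁆; x∈⁅y⁆⇒x≡y; ∉⊥; ∈⊤)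
import Data.Bool.Properties as Bool
open import Data.List using (List; []; _∷_; filter; allFin)
open import Data.List.Membership.Propositional using () renaming (_∈_ to _∈ₗ_)
open import Data.List.Membership.Propositional.Properties using (∈-filter⁺; ∈-filter⁻)
import Data.List.Relation.Unary.All as All
open import Data.List.Relation.Unary.All.Properties using (tabulate⁻)
open import Data.List.Relation.Unary.Any using (here; there)
open import Data.List.Relation.Unary.Unique.DecPropositional using (unique?)
open import Data.Nat using (ℕ; zero; suc; _<_; _<?_; s≤s; z≤n)
open import Data.Nat.Properties using (≤-pred) renaming (_≟_ to _≟ℕ_)
open import Data.Product using (Σ; ∃; _×_; _,_; proj₁)
open import Data.Sum using (inj₁; inj₂)
open import Data.Vec using (Vec; []; _∷_; here; there; lookup; replicate; zipWith; tabulate)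
open import Data.Vec.Properties
  using (lookup-zipWith; lookup-replicate; lookup∘tabulate; []=⇒lookup; lookup⇒[]=; ≡-dec)
open import Level using (Level)
open import Relation.Nullary using (¬_; Dec; yes; no; does; _because_; _×-dec_; _→-dec_)
import Relation.Nullary.Decidable as Dec
open import Relation.Nullary.Reflects using (invert)
open import Relation.Binary.PropositionalEquality using (_≡_; refl; sym; trans; cong; subst)

private
  variable
    ℓ : Level
    A : Set ℓ
    m : ℕ
    x : Fin m
    p : Subset m
    ps : List (Subset m)

-- Applied to `refl`, so that `a?` is evaluated by checking `does a? ≡ true`;
-- checking `tt : True a?` instead is several times slower.
decided : (a? : Dec A) → does a? ≡ true → A
decided (true because [a]) _ = invert [a]

x∈⋃⁺ : p ∈ₗ ps → x ∈ p → x ∈ ⋃ ps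
x∈⋃⁺ (here refl)  x∈p = x∈p∪q⁺ (inj₁ x∈p)
x∈⋃⁺ (there p∈ps) x∈p = x∈p∪q⁺ (inj₂ (x∈⋃⁺ p∈ps x∈p))

x∈⋃⁻ : ∀ (ps : List (Subset m)) → x ∈ ⋃ ps → ∃ λ p → p ∈ₗ ps × x ∈ p
x∈⋃⁻ []       x∈⊥ = ⊥-elim (∉⊥ x∈⊥)
x∈⋃⁻ (p ∷ ps) x∈⋃ with x∈p∪q⁻ p (⋃ ps) x∈⋃
... | inj₁ x∈p = p , here refl , x∈p
... | inj₂ x∈⋃ps with x∈⋃⁻ ps x∈⋃ps
...   | q , q∈ps , x∈q = q , there q∈ps , x∈q

-- Linear-time variant of Data.Fin.Subset.Properties.nonempty?, whose any?-based test is quadratic.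
nonempty?′ : ∀ (p : Subset m) → Dec (Nonempty p)
nonempty?′ []            = no λ ()
nonempty?′ (inside ∷ p)  = yes (zero , here)
nonempty?′ (outside ∷ p) =
  Dec.map′ (λ (x , x∈p) → suc x , there x∈p) (λ { (suc x , there x∈p) → x , x∈p }) (nonempty?′ p)

entry : Vec (Vec ℕ m) m → Fin m → Fin m → ℕ
entry T u w = lookup (lookup T u) w

module BreadthFirst (H : Hypergraph) where

  private
    variable
      S : Subset (n H)
      u w : Fin (n H)
      k f : ℕ

  neighbours : Subset (n H) → Subset (n H)
  neighbours S = ⋃ (filter (λ e → nonempty?′ (e ∩ S)) (edges H))

  ∈-neighbours⁺ : x ∈ S → Adj H x w → w ∈ neighbours S
  ∈-neighbours⁺ {x = x} {S = S} x∈S (e , e∈E , x∈e , w∈e) =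
    x∈⋃⁺ (∈-filter⁺ (λ e → nonempty?′ (e ∩ S)) e∈E (x , x∈p∩q⁺ (x∈e , x∈S))) w∈e

  ∈-neighbours⁻ : w ∈ neighbours S → ∃ λ x → x ∈ S × Adj H x w
  ∈-neighbours⁻ {S = S} w∈N with x∈⋃⁻ _ w∈N
  ... | e , e∈ , w∈e with ∈-filter⁻ (λ e → nonempty?′ (e ∩ S)) e∈
  ...   | e∈E , (x , x∈e∩S) with x∈p∩q⁻ e S x∈e∩S
  ...     | x∈e , x∈S = x , x∈S , (e , e∈E , x∈e , w∈e)

  reach : ℕ → Subset (n H) → Subset (n H)
  reach zero    S = S
  reach (suc k) S = reach k (neighbours S)

  walk⇒∈reach : x ∈ S → Walk H k x w → w ∈ reach k S
  walk⇒∈reach x∈S stop            = x∈S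
  walk⇒∈reach x∈S (step adj walk) = walk⇒∈reach (∈-neighbours⁺ x∈S adj) walk

  ∈reach⇒walk : ∀ k S → w ∈ reach k S → ∃ λ x → x ∈ S × Walk H k x w
  ∈reach⇒walk zero    S w∈S = _ , w∈S , stop
  ∈reach⇒walk (suc k) S w∈  with ∈reach⇒walk k (neighbours S) w∈
  ... | y , y∈N , walk with ∈-neighbours⁻ y∈N
  ...   | x , x∈S , adj = x , x∈S , step adj walk

  -- lookup (levels f S) w is the least k < f with w ∈ reach k S, and f if there is none.
  levels : ℕ → Subset (n H) → Vec ℕ (n H)
  levels zero    S = replicate _ 0
  levels (suc f) S = zipWith (λ s d → if s then 0 else suc d) S (levels f (neighbours S))

  lookup-levels : ∀ f S w → lookup (levels (suc f) S) w
                  ≡ (if lookup S w then 0 else suc (lookup (levels f (neighbours S)) w))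
  lookup-levels f S w = lookup-zipWith _ w S (levels f (neighbours S))

  level-reached : ∀ f S w → lookup (levels f S) w < f → w ∈ reach (lookup (levels f S) w) S
  level-reached (suc f) S w d<f rewrite lookup-levels f S w with lookup S w in w∈?S
  ... | inside  = lookup⇒[]= w S w∈?S
  ... | outside = level-reached f (neighbours S) w (≤-pred d<f)

  level-minimal : ∀ f S w → k < lookup (levels f S) w → w ∉ reach k S
  level-minimal zero S w k<d w∈ rewrite lookup-replicate w 0 with k<d
  ... | ()
  level-minimal (suc f) S w k<d w∈ rewrite lookup-levels f S w with lookup S w in w∈?S
  level-minimal {zero}  (suc f) S w k<d w∈ | outside with trans (sym ([]=⇒lookup w∈)) w∈?S
  ... | ()
  level-minimal {suc k} (suc f) S w (s≤s k<d) w∈ | outside = level-minimal f (neighbours S) w k<d w∈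

  level-isDist : ∀ f u w → lookup (levels f ⁅ u ⁆) w < f → IsDist H u w (lookup (levels f ⁅ u ⁆) w)
  level-isDist f u w d<f with ∈reach⇒walk _ ⁅ u ⁆ (level-reached f ⁅ u ⁆ w d<f)
  ... | x , x∈⁅u⁆ , walk =
    subst (λ x → Walk H _ x w) (x∈⁅y⁆⇒x≡y u x∈⁅u⁆) walk ,
    λ k k<d walk′ → level-minimal f ⁅ u ⁆ w k<d (walk⇒∈reach (x∈⁅x⁆ u) walk′)

  -- Going through a table makes evaluation run each search once and share it among all lookups.
  bfsDistance : ℕ → Fin (n H) → Fin (n H) → ℕ
  bfsDistance f = entry (tabulate (λ u → levels f ⁅ u ⁆))

  bfsDistance-isDist : ∀ f u w → bfsDistance f u w < f → IsDist H u w (bfsDistance f u w)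
  bfsDistance-isDist f u w
    rewrite cong (λ row → lookup row w) (lookup∘tabulate (λ u → levels f ⁅ u ⁆) u) = level-isDist f u w

  BoundedBy : ℕ → (Fin (n H) → Fin (n H) → ℕ) → Set
  BoundedBy f δ = ∀ u → u ∈ vertices H → ∀ w → w ∈ vertices H → δ u w < f

  boundedBy? : ∀ f δ → Dec (BoundedBy f δ)
  boundedBy? f δ = all? λ u → u ∈? vertices H →-dec all? λ w → w ∈? vertices H →-dec δ u w <? f

  WienerCertificate : ℕ → (Fin (n H) → Fin (n H) → ℕ) → ℕ → Set
  WienerCertificate f δ m = BoundedBy f δ × m ≡ pairSum H δ

  wienerCertificate? : ∀ f δ m → Dec (WienerCertificate f δ m)
  wienerCertificate? f δ m = boundedBy? f δ ×-dec m ≟ℕ pairSum H δ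

  bounded⇒connected : BoundedBy f (bfsDistance f) → Connected H
  bounded⇒connected {f} bounded u w u∈V w∈V =
    _ , proj₁ (bfsDistance-isDist f u w (bounded u u∈V w w∈V))

  certificate⇒wienerIs : WienerCertificate f (bfsDistance f) m → WienerIs H m
  certificate⇒wienerIs {f} (bounded , m≡) =
    bfsDistance f , (λ u w u∈V w∈V _ → bfsDistance-isDist f u w (bounded u u∈V w w∈V)) , m≡

open BreadthFirst

certificates⇒soltes : ∀ H f m → WienerCertificate H f (bfsDistance H f) m →
               (∀ v → v ∈ vertices H → WienerCertificate (delete H v) f (bfsDistance (delete H v) f) m) →
               Soltes H
certificates⇒soltes H f m certificate certificate∖ =
  bounded⇒connected H (proj₁ certificate) ,
  λ v v∈V → m , certificate⇒wienerIs H certificate , certificate⇒wienerIs (delete H v) (certificate∖ v v∈V)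

H54-isHypergraph : IsHypergraph H54
H54-isHypergraph = All.tabulate (λ _ _ → ∈⊤) , decided (unique? (≡-dec Bool._≟_) (edges H54)) refl

H54-uniform : KUniform 9 H54
H54-uniform = decided (All.all? (λ e → ∣ e ∣ ≟ℕ 9) (edges H54)) refl

-- Even vertices lie in five hyperedges (offsets 0, 2, 4, 16, 18), odd ones in four (1, 3, 5, 7).
H54-irregular : ¬ Regular H54
H54-irregular regular with regular zero (suc zero) ∈⊤ ∈⊤
... | ()

H54-certificate : WienerCertificate H54 4 (bfsDistance H54 4) 2349
H54-certificate = decided (wienerCertificate? H54 4 (bfsDistance H54 4) 2349) refl

-- Quantifying over the list allFin 54: evaluating Data.Fin.Properties.all? here is far slower.
H54∖v-certificate : ∀ v → WienerCertificate (delete H54 v) 4 (bfsDistance (delete H54 v) 4) 2349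
H54∖v-certificate = tabulate⁻ (decided
  (All.all? (λ v → wienerCertificate? (delete H54 v) 4 (bfsDistance (delete H54 v) 4) 2349) (allFin 54)) refl)

H54-soltes : Soltes H54
H54-soltes = certificates⇒soltes H54 4 2349 H54-certificate (λ v _ → H54∖v-certificate v)

mainTheorem3 : (Σ Hypergraph λ H → IsHypergraph H × Uniform H × Soltes H × ¬ Regular H)
               × (IsHypergraph H54 × KUniform 9 H54 × Soltes H54 × ¬ Regular H54)
mainTheorem3 = (H54 , H54-isHypergraph , (9 , s≤s (s≤s z≤n) , H54-uniform) , H54-soltes , H54-irregular)
             , (H54-isHypergraph , H54-uniform , H54-soltes , H54-irregular)
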